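{- Let $E$ be an apartness space and let $X_0,X_1\subset E$ be precompact (as subspaces with the apartness induced from $E$). Then $X_0\cup X_1$ is precompact.
   Context: Work in Bishop-style constructive mathematics (intuitionistic logic). For an inhabited set $Z$ with inequality $\neq$ and a relation $\bowtie$ between subsets, write $x\bowtie S$ for $\{x\}\bowtie S$, ${\sim}S=\{z:\forall_{s\in S}(z\neq s)\}$ and $-S=\{z:z\bowtie S\}$. $\bowtie$ is an apartness if (B1) $Z\bowtie\varnothing$; (B2) $-A\subset{\sim}A$; (B3) $(A_1\cup A_2)\bowtie(B_1\cup B_2)$ iff $A_i\bowtie B_j$ for all $i,j$; (B4) $-A\subset{\sim}B\Rightarrow-A\subset-B$; (B5) $z\in-A\Rightarrow\exists_S(z\in-S\wedge Z=-A\cup S)$; apartness spaces are assumed symmetric. A subset carries the induced apartness. The apartness topology has base the sets $-S$; a subset $D$ is dense if whenever $z\in -S$ there is $d\in D\cap -S$. A map $f$ is strongly continuous if $f(A)\bowtie f(B)\Rightarrow A\bowtie B$. $2^{\mathbf{N}}$ is the space of binary sequences with its usual compact metric and the metric apartness $S\bowtie T\Leftrightarrow\exists_{\varepsilon>0}\forall_{s\in S,t\in T}\rho(s,t)\ge\varepsilon$. An apartness space $X$ is precompact if there exist a dense subset $D$ of $2^{\mathbf{N}}$ and a strongly continuous mapping of $D$ onto a dense subset of $X$. -}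

module Defs where

open import Level using (0ℓ)
open import Data.Nat using (ℕ; _≤_)
open import Data.Bool using (Bool)
open import Data.Unit using (⊤; tt)
open import Data.Product using (Σ; _×_; _,_; proj₁; proj₂)
open import Data.Sum using (_⊎_; inj₁; inj₂)
import Data.Sum as Sum
open import Data.Empty using (⊥)
open import Relation.Nullary using (¬_)
open import Relation.Binary.Bundles using (Setoid)
open import Relation.Binary.PropositionalEquality as P using (_≡_; _≢_)

-- Bishop subsets of a (Bishop) set, i.e. of a setoid: predicates
-- closed under the set's equality.

record Subset (S : Setoid 0ℓ 0ℓ) : Set₁ where
  open Setoid S
  field
    mem  : Carrier → Set
    resp : ∀ {x y} → x ≈ y → mem x → mem y
open Subset public

module _ {S : Setoid 0ℓ 0ℓ} where
  open Setoid S

  _∈_ : Carrier → Subset S → Set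
  x ∈ A = mem A x

  _⊆_ : Subset S → Subset S → Set
  A ⊆ B = ∀ x → x ∈ A → x ∈ B

  _≐_ : Subset S → Subset S → Set
  A ≐ B = (A ⊆ B) × (B ⊆ A)

  ∅ : Subset S
  ∅ = record { mem = λ _ → ⊥ ; resp = λ _ () }

  Whole : Subset S
  Whole = record { mem = λ _ → ⊤ ; resp = λ _ _ → tt }

  _∪_ : Subset S → Subset S → Subset S
  A ∪ B = record { mem = λ x → x ∈ A ⊎ x ∈ B
                 ; resp = λ e → Sum.map (resp A e) (resp B e) }

  ⟨_⟩ : Carrier → Subset S
  ⟨ x ⟩ = record { mem = λ y → y ≈ x ; resp = λ e p → trans (sym e) p }

record PreApartness : Set₁ where
  field
    setoid : Setoid 0ℓ 0ℓ
  open Setoid setoid public using (Carrier; _≈_)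
  field
    _≠_      : Carrier → Carrier → Set
    ≠-irrefl : ∀ {x y} → x ≠ y → ¬ (x ≈ y)
    ≠-sym    : ∀ {x y} → x ≠ y → y ≠ x
    ≠-resp   : ∀ {x x' y y'} → x ≈ x' → y ≈ y' → x ≠ y → x' ≠ y'
    _⋈_      : Subset setoid → Subset setoid → Set
    ⋈-resp   : ∀ {A A' B B'} → A ≐ A' → B ≐ B' → A ⋈ B → A' ⋈ B'

module _ (X : PreApartness) where
  open PreApartness X
  open Setoid setoid

  ⋈-compl : Subset setoid → Subset setoid
  ⋈-compl S = record
    { mem  = λ z → ⟨ z ⟩ ⋈ S
    ; resp = λ {x} {y} e p →
        ⋈-resp ((λ w q → trans q e) , (λ w q → trans q (sym e)))
               ((λ _ q → q) , (λ _ q → q)) p }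

  ≠-compl : Subset setoid → Subset setoid
  ≠-compl S = record
    { mem  = λ z → ∀ s → s ∈ S → z ≠ s
    ; resp = λ e h s p → ≠-resp e refl (h s p) }

record ApartnessSpace : Set₁ where
  field
    pre : PreApartness
  open PreApartness pre
  field
    inhabited : Carrier
    B1 : Whole ⋈ ∅
    B2 : ∀ A → ⋈-compl pre A ⊆ ≠-compl pre A
    B3 : ∀ A₁ A₂ B₁ B₂ →
           (((A₁ ∪ A₂) ⋈ (B₁ ∪ B₂)) →
              ((A₁ ⋈ B₁) × (A₁ ⋈ B₂)) × ((A₂ ⋈ B₁) × (A₂ ⋈ B₂)))
         × (((A₁ ⋈ B₁) × (A₁ ⋈ B₂)) × ((A₂ ⋈ B₁) × (A₂ ⋈ B₂)) →
              ((A₁ ∪ A₂) ⋈ (B₁ ∪ B₂)))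
    B4 : ∀ A B → ⋈-compl pre A ⊆ ≠-compl pre B → ⋈-compl pre A ⊆ ⋈-compl pre B
    B5 : ∀ A z → z ∈ ⋈-compl pre A →
           Σ (Subset setoid) λ S → (z ∈ ⋈-compl pre S)
             × (∀ x → (x ∈ ⋈-compl pre A) ⊎ (x ∈ S))
    symmetric : ∀ A B → A ⋈ B → B ⋈ A

subSetoid : (S : Setoid 0ℓ 0ℓ) → Subset S → Setoid 0ℓ 0ℓ
subSetoid S X = record
  { Carrier = Σ (Setoid.Carrier S) (mem X)
  ; _≈_ = λ a b → Setoid._≈_ S (proj₁ a) (proj₁ b)
  ; isEquivalence = record { refl = Setoid.refl S ; sym = Setoid.sym S
                           ; trans = Setoid.trans S } }

embed : {S : Setoid 0ℓ 0ℓ} (X : Subset S) → Subset (subSetoid S X) → Subset S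
embed {S} X A = record
  { mem  = λ z → Σ (Σ (Setoid.Carrier S) (mem X)) λ w → (w ∈ A) × Setoid._≈_ S (proj₁ w) z
  ; resp = λ e (w , a , p) → w , a , Setoid.trans S p e }

embed-⊆ : {S : Setoid 0ℓ 0ℓ} (X : Subset S) {A B : Subset (subSetoid S X)} →
          A ⊆ B → embed X A ⊆ embed X B
embed-⊆ X h z (w , a , p) = w , h w a , p

sub : (E : PreApartness) → Subset (PreApartness.setoid E) → PreApartness
sub E X = record
  { setoid   = subSetoid setoid X
  ; _≠_      = λ a b → proj₁ a ≠ proj₁ b
  ; ≠-irrefl = λ {a} {b} → ≠-irrefl {proj₁ a} {proj₁ b}
  ; ≠-sym    = λ {a} {b} → ≠-sym {proj₁ a} {proj₁ b}
  ; ≠-resp   = λ {a} {a'} {b} {b'} → ≠-resp {proj₁ a} {proj₁ a'} {proj₁ b} {proj₁ b'}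
  ; _⋈_      = λ A B → embed X A ⋈ embed X B
  ; ⋈-resp   = λ {A} {A'} {B} {B'} (a , a') (b , b') →
      ⋈-resp (embed-⊆ X {A} {A'} a , embed-⊆ X {A'} {A} a')
             (embed-⊆ X {B} {B'} b , embed-⊆ X {B'} {B} b') }
  where open PreApartness E

-- For ρ(s,t) = 2^{-min{n : s n ≠ t n}} one has ρ(s,t) ≥ 2^{-N} iff
-- s and t differ at some n ≤ N, so  S ⋈ T ⇔ ∃ε>0 ∀s∈S,t∈T ρ(s,t) ≥ ε
-- becomes the condition below.

CantorSetoid : Setoid 0ℓ 0ℓ
CantorSetoid = record
  { Carrier = ℕ → Bool
  ; _≈_ = λ s t → ∀ n → s n ≡ t n
  ; isEquivalence = record { refl = λ _ → P.refl ; sym = λ e n → P.sym (e n)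
                           ; trans = λ e f n → P.trans (e n) (f n) } }

Cantor : PreApartness
Cantor = record
  { setoid   = CantorSetoid
  ; _≠_      = λ s t → Σ ℕ λ n → s n ≢ t n
  ; ≠-irrefl = λ (n , ne) e → ne (e n)
  ; ≠-sym    = λ (n , ne) → n , (λ q → ne (P.sym q))
  ; ≠-resp   = λ e f (n , ne) → n , (λ q → ne (P.trans (e n) (P.trans q (P.sym (f n)))))
  ; _⋈_      = λ S T → Σ ℕ λ N → ∀ s t → s ∈ S → t ∈ T →
                  Σ ℕ λ n → (n ≤ N) × (s n ≢ t n)
  ; ⋈-resp   = λ (_ , a') (_ , b') (N , h) →
      N , (λ s t p q → h s t (a' s p) (b' t q)) }

record Map (X Y : PreApartness) : Set where
  field
    fun  : PreApartness.Carrier X → PreApartness.Carrier Y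
    cong : ∀ {x y} → PreApartness._≈_ X x y → PreApartness._≈_ Y (fun x) (fun y)
open Map public

image : {X Y : PreApartness} → Map X Y → Subset (PreApartness.setoid X) →
        Subset (PreApartness.setoid Y)
image {X} {Y} f A = record
  { mem  = λ y → Σ (PreApartness.Carrier X) λ x → (x ∈ A) × PreApartness._≈_ Y (fun f x) y
  ; resp = λ e (x , a , p) → x , a , Setoid.trans (PreApartness.setoid Y) p e }

StronglyContinuous : {X Y : PreApartness} → Map X Y → Set₁
StronglyContinuous {X} {Y} f =
  ∀ A B → PreApartness._⋈_ Y (image f A) (image f B) → PreApartness._⋈_ X A B

-- D is dense in X (w.r.t. the apartness topology with base the sets −S)
Dense : (X : PreApartness) → Subset (PreApartness.setoid X) → Set₁
Dense X D = ∀ S z → z ∈ ⋈-compl X S →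
  Σ (PreApartness.Carrier X) λ d → (d ∈ D) × (d ∈ ⋈-compl X S)

Precompact : PreApartness → Set₁
Precompact X =
  Σ (Subset CantorSetoid) λ D → Dense Cantor D ×
    Σ (Map (sub Cantor D) X) λ f → StronglyContinuous f × Dense X (image f Whole)

{-# OPTIONS --safe #-}
module Submission where

-- Glue the two witnesses along the first bit: a sequence b ∷ u lies in the
-- joined dense set iff u lies in D_b, and it is sent to f_b(u). Two sets of
-- sequences are apart iff they are apart on each half of 2^ℕ (sequences that
-- start differently are at distance 1), which gives strong continuity from
-- that of f₀ and f₁. For density, a point of X_b apart from S is also apart
-- from the set T that B5 provides; density in X_b yields a point of the image
-- apart from T, and by B2 such a point cannot lie in T, so it lies in −S.

open import Defs
open import Data.Nat using (ℕ; zero; suc; _≤_; z≤n; s≤s; _⊔_)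
open import Data.Nat.Properties using (≤-trans; n≤1+n; m≤m⊔n; m≤n⊔m)
open import Data.Bool using (Bool; true; false; if_then_else_; _≟_)
open import Data.Unit using (tt)
open import Data.Product using (Σ; _×_; _,_; proj₁; proj₂; swap)
open import Data.Sum using (inj₁; inj₂; [_,_])
open import Data.Empty using (⊥-elim)
open import Relation.Nullary using (yes; no)
open import Relation.Binary.Bundles using (Setoid)
open import Relation.Binary.PropositionalEquality using (_≡_; _≢_; refl; sym; trans; subst)

open Setoid CantorSetoid using ()
  renaming (_≈_ to _≈ᶜ_; refl to ≈ᶜ-refl; sym to ≈ᶜ-sym)
open PreApartness Cantor using () renaming (_⋈_ to _⋈ᶜ_)

tail : (ℕ → Bool) → ℕ → Bool
tail s n = s (suc n)

cons : Bool → (ℕ → Bool) → ℕ → Bool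
cons b u zero    = b
cons b u (suc n) = u n

cons-cong : ∀ b {u v} → u ≈ᶜ v → cons b u ≈ᶜ cons b v
cons-cong b u≈v zero    = refl
cons-cong b u≈v (suc n) = u≈v n

cons-≈ : ∀ {b u s} → b ≡ s 0 → u ≈ᶜ tail s → cons b u ≈ᶜ s
cons-≈ b≡s₀ u≈ zero    = b≡s₀
cons-≈ b≡s₀ u≈ (suc n) = u≈ n

Branch : Bool → Subset CantorSetoid → Subset CantorSetoid
Branch b S = record { mem = λ u → cons b u ∈ S ; resp = λ u≈v → resp S (cons-cong b u≈v) }

⋈ᶜ-antitone : ∀ {A A′ B B′ : Subset CantorSetoid} → A′ ⊆ A → B′ ⊆ B → A ⋈ᶜ B → A′ ⋈ᶜ B′
⋈ᶜ-antitone A′⊆A B′⊆B (N , apart) = N , λ s t s∈A′ t∈B′ → apart s t (A′⊆A s s∈A′) (B′⊆B t t∈B′)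

tail-⋈ᶜ : ∀ {S : Subset CantorSetoid} {z} → ⟨ z ⟩ ⋈ᶜ S → ⟨ tail z ⟩ ⋈ᶜ Branch (z 0) S
tail-⋈ᶜ {z = z} (N , apart) = N , λ s t s≈ t∈ →
  unshift (apart (cons (z 0) s) (cons (z 0) t) (cons-≈ refl s≈) t∈)
  where
    unshift : ∀ {s t} → Σ ℕ (λ n → n ≤ N × cons (z 0) s n ≢ cons (z 0) t n) →
              Σ ℕ λ n → n ≤ N × s n ≢ t n
    unshift (zero  , _      , ne) = ⊥-elim (ne refl)
    unshift (suc n , 1+n≤N , ne) = n , ≤-trans (n≤1+n n) 1+n≤N , ne

cons-⋈ᶜ : ∀ {S : Subset CantorSetoid} {b d} → ⟨ d ⟩ ⋈ᶜ Branch b S → ⟨ cons b d ⟩ ⋈ᶜ S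
cons-⋈ᶜ {S} {b} {d} (M , apart) = suc M , separate
  where
    separate : ∀ s t → s ≈ᶜ cons b d → t ∈ S → Σ ℕ λ n → n ≤ suc M × s n ≢ t n
    separate s t s≈ t∈S with b ≟ t 0
    ... | no b≢t₀ = 0 , z≤n , λ s₀≡t₀ → b≢t₀ (trans (sym (s≈ 0)) s₀≡t₀)
    ... | yes b≡t₀
      with apart (tail s) (tail t) (λ n → s≈ (suc n)) (resp S (≈ᶜ-sym (cons-≈ b≡t₀ ≈ᶜ-refl)) t∈S)
    ...   | m , m≤M , ne = suc m , s≤s m≤M , ne

⋈ᶜ-from-Branches : ∀ {S T : Subset CantorSetoid} → (∀ b → Branch b S ⋈ᶜ Branch b T) → S ⋈ᶜ T
⋈ᶜ-from-Branches {S} {T} apart = suc (N false ⊔ N true) , separate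
  where
    N : Bool → ℕ
    N b = proj₁ (apart b)

    N≤⊔ : ∀ b → N b ≤ N false ⊔ N true
    N≤⊔ false = m≤m⊔n (N false) (N true)
    N≤⊔ true  = m≤n⊔m (N false) (N true)

    separate : ∀ s t → s ∈ S → t ∈ T → Σ ℕ λ n → n ≤ suc (N false ⊔ N true) × s n ≢ t n
    separate s t s∈S t∈T with s 0 ≟ t 0
    ... | no s₀≢t₀ = 0 , z≤n , s₀≢t₀
    ... | yes s₀≡t₀
      with proj₂ (apart (s 0)) (tail s) (tail t)
             (resp S (≈ᶜ-sym (cons-≈ refl ≈ᶜ-refl)) s∈S)
             (resp T (≈ᶜ-sym (cons-≈ s₀≡t₀ ≈ᶜ-refl)) t∈T)
    ...   | n , n≤N , ne = suc n , s≤s (≤-trans n≤N (N≤⊔ (s 0))) , ne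

Join : (Bool → Subset CantorSetoid) → Subset CantorSetoid
Join D = record
  { mem  = λ s → tail s ∈ D (s 0)
  ; resp = λ {s} {t} s≈t s∈ →
      resp (D (t 0)) (λ n → s≈t (suc n)) (subst (λ b → tail s ∈ D b) (s≈t 0) s∈) }

Join-dense : ∀ {D : Bool → Subset CantorSetoid} → (∀ b → Dense Cantor (D b)) → Dense Cantor (Join D)
Join-dense dense S z z∈−S with dense (z 0) (Branch (z 0) S) (tail z) (tail-⋈ᶜ {S} {z} z∈−S)
... | d , d∈D , d∈− = cons (z 0) d , d∈D , cons-⋈ᶜ {S} {z 0} {d} d∈−

module _ (E : ApartnessSpace) where
  open ApartnessSpace E
  open PreApartness pre
  open Setoid setoid using () renaming (refl to ≈-refl; sym to ≈-sym; trans to ≈-trans)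

  ≐-refl : ∀ {S : Subset setoid} → S ≐ S
  ≐-refl = (λ _ x∈ → x∈) , (λ _ x∈ → x∈)

  ⋈-antitone : ∀ {A A′ B B′ : Subset setoid} → A′ ⊆ A → B′ ⊆ B → A ⋈ B → A′ ⋈ B′
  ⋈-antitone {A} {A′} {B} {B′} A′⊆A B′⊆B A⋈B = proj₁ (proj₁ (proj₁ (B3 A′ A B′ B) A′∪A⋈B′∪B))
    where
      absorb : ∀ C C′ → C′ ⊆ C → C ≐ (C′ ∪ C)
      absorb C C′ C′⊆C = (λ _ → inj₂) , (λ x → [ C′⊆C x , (λ x∈C → x∈C) ])

      A′∪A⋈B′∪B : (A′ ∪ A) ⋈ (B′ ∪ B)
      A′∪A⋈B′∪B = ⋈-resp {A} {A′ ∪ A} {B} {B′ ∪ B} (absorb A A′ A′⊆A) (absorb B B′ B′⊆B) A⋈B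

  embed-⟨⟩ : ∀ (X : Subset setoid) (w : Σ Carrier (mem X)) → embed X ⟨ w ⟩ ≐ ⟨ proj₁ w ⟩
  embed-⟨⟩ X w = (λ z (v , v≈w , v≈z) → ≈-trans (≈-sym v≈z) v≈w)
               , (λ z z≈w → w , ≈-refl , ≈-sym z≈w)

  ⋈-compl-sub⇒embed : ∀ {X : Subset setoid} {S : Subset (subSetoid setoid X)}
                        {w : Σ Carrier (mem X)} →
                      w ∈ ⋈-compl (sub pre X) S → proj₁ w ∈ ⋈-compl pre (embed X S)
  ⋈-compl-sub⇒embed {X} {S} {w} =
    ⋈-resp {embed X ⟨ w ⟩} {⟨ proj₁ w ⟩} {embed X S} {embed X S}
      (embed-⟨⟩ X w) (≐-refl {embed X S})

  ⋈-compl-embed⇒sub : ∀ {X : Subset setoid} {S : Subset (subSetoid setoid X)}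
                        {w : Σ Carrier (mem X)} →
                      proj₁ w ∈ ⋈-compl pre (embed X S) → w ∈ ⋈-compl (sub pre X) S
  ⋈-compl-embed⇒sub {X} {S} {w} =
    ⋈-resp {⟨ proj₁ w ⟩} {embed X ⟨ w ⟩} {embed X S} {embed X S}
      (swap (embed-⟨⟩ X w)) (≐-refl {embed X S})

  restrict : (X : Subset setoid) → Subset setoid → Subset (subSetoid setoid X)
  restrict X T = record { mem = λ w → proj₁ w ∈ T ; resp = resp T }

  embed-restrict⊆ : ∀ X T → embed X (restrict X T) ⊆ T
  embed-restrict⊆ X T z (w , w∈T , w≈z) = resp T w≈z w∈T

  dense-sub-meets-⋈-compl : ∀ {X : Subset setoid} {D : Subset (subSetoid setoid X)} →
    Dense (sub pre X) D → ∀ S (w : Σ Carrier (mem X)) → proj₁ w ∈ ⋈-compl pre S →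
    Σ (Σ Carrier (mem X)) λ d → d ∈ D × proj₁ d ∈ ⋈-compl pre S
  dense-sub-meets-⋈-compl {X} dense S w w∈−S with B5 S (proj₁ w) w∈−S
  ... | T , w∈−T , cover with dense (restrict X T) w w∈−T|X
    where
      w∈−T|X : w ∈ ⋈-compl (sub pre X) (restrict X T)
      w∈−T|X = ⋈-compl-embed⇒sub {X} {restrict X T} {w}
                 (⋈-antitone {⟨ proj₁ w ⟩} {⟨ proj₁ w ⟩} {T}
                   (λ _ x∈ → x∈) (embed-restrict⊆ X T) w∈−T)
  ...   | d , d∈D , d∈−T|X with cover (proj₁ d)
  ...     | inj₁ d∈−S = d , d∈D , d∈−S
  ...     | inj₂ d∈T  = ⊥-elim (≠-irrefl (d≠d (proj₁ d) (d , d∈T , ≈-refl)) ≈-refl)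
    where
      d≠d : proj₁ d ∈ ≠-compl pre (embed X (restrict X T))
      d≠d = B2 _ (proj₁ d) (⋈-compl-sub⇒embed {X} {restrict X T} {d} d∈−T|X)

  module _ (X : Bool → Subset setoid) where

    U : Subset setoid
    U = X false ∪ X true

    ∪-inj : ∀ b {x} → x ∈ X b → x ∈ U
    ∪-inj false = inj₁
    ∪-inj true  = inj₂

    module _ {D : Bool → Subset CantorSetoid}
             (f : ∀ b → Map (sub Cantor (D b)) (sub pre (X b))) where

      join-fun : Σ (ℕ → Bool) (mem (Join D)) → Σ Carrier (mem U)
      join-fun (s , s∈D) = proj₁ (fun (f (s 0)) (tail s , s∈D))
                         , ∪-inj (s 0) (proj₂ (fun (f (s 0)) (tail s , s∈D)))

      fun-cong : ∀ {b c} → b ≡ c → ∀ {u v} (u∈D : u ∈ D b) (v∈D : v ∈ D c) → u ≈ᶜ v →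
                 proj₁ (fun (f b) (u , u∈D)) ≈ proj₁ (fun (f c) (v , v∈D))
      fun-cong refl u∈D v∈D u≈v = cong (f _) u≈v

      join : Map (sub Cantor (Join D)) (sub pre U)
      join = record
        { fun  = join-fun
        ; cong = λ {x} {y} x≈y → fun-cong (x≈y 0) (proj₂ x) (proj₂ y) (λ n → x≈y (suc n)) }

      subBranch : ∀ b → Subset (subSetoid CantorSetoid (Join D)) →
                        Subset (subSetoid CantorSetoid (D b))
      subBranch b A = record
        { mem  = λ w → (cons b (proj₁ w) , proj₂ w) ∈ A
        ; resp = λ u≈v → resp A (cons-cong b u≈v) }

      image-subBranch⊆ : ∀ b A → embed (X b) (image (f b) (subBranch b A)) ⊆ embed U (image join A)
      image-subBranch⊆ b A y (w , (u , u∈A , fu≈w) , w≈y) =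
        (proj₁ w , ∪-inj b (proj₂ w)) , ((cons b (proj₁ u) , proj₂ u) , u∈A , fu≈w) , w≈y

      Branch-embed⊆ : ∀ b A → Branch b (embed (Join D) A) ⊆ embed (D b) (subBranch b A)
      Branch-embed⊆ b A u ((w , w∈D) , w∈A , w≈bu) =
        (tail w , subst (λ c → tail w ∈ D c) (w≈bu 0) w∈D)
        , resp A (≈ᶜ-sym (cons-≈ (sym (w≈bu 0)) ≈ᶜ-refl)) w∈A
        , (λ n → w≈bu (suc n))

      join-stronglyContinuous : (∀ b → StronglyContinuous (f b)) → StronglyContinuous join
      join-stronglyContinuous sc A B fA⋈fB =
        ⋈ᶜ-from-Branches {embed (Join D) A} {embed (Join D) B} λ b →
          ⋈ᶜ-antitone {embed (D b) (subBranch b A)} {Branch b (embed (Join D) A)}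
                      {embed (D b) (subBranch b B)} {Branch b (embed (Join D) B)}
            (Branch-embed⊆ b A) (Branch-embed⊆ b B)
            (sc b (subBranch b A) (subBranch b B)
              (⋈-antitone {embed U (image join A)} {embed (X b) (image (f b) (subBranch b A))}
                          {embed U (image join B)} {embed (X b) (image (f b) (subBranch b B))}
                (image-subBranch⊆ b A) (image-subBranch⊆ b B) fA⋈fB))

      image-join-meets : (∀ b → Dense (sub pre (X b)) (image (f b) Whole)) →
        ∀ S b {x} (x∈X : x ∈ X b) → (x , ∪-inj b x∈X) ∈ ⋈-compl (sub pre U) S →
        Σ (Σ Carrier (mem U)) λ d → d ∈ image join Whole × d ∈ ⋈-compl (sub pre U) S
      image-join-meets dense S b {x} x∈X x∈−S
        with dense-sub-meets-⋈-compl {X b} {image (f b) Whole} (dense b) (embed U S) (x , x∈X)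
               (⋈-compl-sub⇒embed {U} {S} {x , ∪-inj b x∈X} x∈−S)
      ... | (y , y∈X) , ((u , u∈D) , _ , fu≈y) , y∈−S =
        (y , ∪-inj b y∈X) , ((cons b u , u∈D) , tt , fu≈y)
        , ⋈-compl-embed⇒sub {U} {S} {y , ∪-inj b y∈X} y∈−S

      join-image-dense : (∀ b → Dense (sub pre (X b)) (image (f b) Whole)) →
                         Dense (sub pre U) (image join Whole)
      join-image-dense dense S (x , inj₁ x∈X₀) = image-join-meets dense S false x∈X₀
      join-image-dense dense S (x , inj₂ x∈X₁) = image-join-meets dense S true x∈X₁

    ∪-precompact : (∀ b → Precompact (sub pre (X b))) → Precompact (sub pre (X false ∪ X true))
    ∪-precompact P =
      Join D , Join-dense {D} dense , join {D} f ,
      join-stronglyContinuous {D} f sc , join-image-dense {D} f image-dense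
      where
        D : Bool → Subset CantorSetoid
        D b = proj₁ (P b)

        dense : ∀ b → Dense Cantor (D b)
        dense b = proj₁ (proj₂ (P b))

        f : ∀ b → Map (sub Cantor (D b)) (sub pre (X b))
        f b = proj₁ (proj₂ (proj₂ (P b)))

        sc : ∀ b → StronglyContinuous (f b)
        sc b = proj₁ (proj₂ (proj₂ (proj₂ (P b))))

        image-dense : ∀ b → Dense (sub pre (X b)) (image (f b) Whole)
        image-dense b = proj₂ (proj₂ (proj₂ (proj₂ (P b))))

proposition3p2 : (E : ApartnessSpace) (X₀ X₁ : Subset (PreApartness.setoid (ApartnessSpace.pre E))) →
    Precompact (sub (ApartnessSpace.pre E) X₀) →
    Precompact (sub (ApartnessSpace.pre E) X₁) →
    Precompact (sub (ApartnessSpace.pre E) (X₀ ∪ X₁))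
proposition3p2 E X₀ X₁ P₀ P₁ =
  ∪-precompact E (λ b → if b then X₁ else X₀) λ { false → P₀ ; true → P₁ }
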